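{- Let $\mathtt{TWIN}=\{wcw\mid w\in\{a,b\}^*\}$ over the alphabet $\{a,b,c\}$. Then $\mathtt{TWIN}\in\mathsf{oneway\mbox{ - }IP}(\mathrm{cons\mbox{ - }space},\mathrm{cons\mbox{ - }random\mbox{ - }bits},\mathrm{rt\mbox{ - }input})$.
   Context: A verifier is a probabilistic Turing machine with a read-only input tape (input between two end-markers), one read/write work tape, fair random bits, and a certificate (the one-way prover's message sequence, which depends only on the input) read by a head that never moves left (but may stay put). A (strong) one-way interactive proof system with error $\varepsilon$ for $L$: some certificate makes every $x\in L$ accepted with probability $\ge1-\varepsilon$, and for $x\notin L$ every certificate leads to rejection with probability $\ge1-\varepsilon$. $\mathsf{oneway\mbox{ - }IP}(\cdot)$ is the class of languages with such systems with some $\varepsilon<\frac12$ whose verifier satisfies: cons-space = $O(1)$ work-tape cells; cons-random-bits = number of coin tosses bounded by a constant independent of the input; rt-input = the input head moves right at every step (real-time). -}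

module Defs where

open import Data.Nat using (ℕ; zero; suc; pred; _≤_; _<_; _⊔_) renaming (_+_ to _+ℕ_)
open import Data.Nat.Properties using () renaming (_≟_ to _≟ℕ_)
open import Data.Fin using (Fin; _≟_)
open import Data.Bool using (Bool; true; false; if_then_else_)
open import Data.List using (List; []; _∷_; _++_; map; [_])
open import Data.Product using (Σ; ∃; _×_; _,_)
open import Data.Rational using (ℚ; 0ℚ; 1ℚ; ½; _+_; _*_; _-_) renaming (_≤_ to _≤ℚ_; _<_ to _<ℚ_)
open import Relation.Nullary using (¬_)
open import Relation.Nullary.Decidable using (⌊_⌋)
open import Relation.Binary.PropositionalEquality using (_≡_)

data Sym : Set where
  a b c : Sym

data IsAB : Sym → Set where
  isA : IsAB a
  isB : IsAB b

data AllAB : List Sym → Set where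
  []  : AllAB []
  _∷_ : ∀ {s w} → IsAB s → AllAB w → AllAB (s ∷ w)

TWIN : List Sym → Set
TWIN x = Σ (List Sym) λ w → AllAB w × (x ≡ w ++ (c ∷ w))

data TSym : Set where
  ¢   : TSym
  sym : Sym → TSym
  $   : TSym

inputTape : List Sym → List TSym
inputTape x = ¢ ∷ (map sym x ++ [ $ ])

-- Verifiers with a real-time input head (the input head moves right at
-- every step; this is built into the model: step t reads tape cell t).

-- work-tape head moves (moving left on cell 0 leaves the head on cell 0)
data Move : Set where
  left stay right : Move

record Action (nQ nW : ℕ) : Set where
  field
    next    : Fin nQ
    write   : Fin nW
    wmove   : Move
    advance : Bool          -- certificate head: true = move right, false = stay

data Trans (nQ nW : ℕ) : Set where
  det  : Action nQ nW → Trans nQ nW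
  coin : Action nQ nW → Action nQ nW → Trans nQ nW

record Verifier : Set where
  field
    nQ : ℕ
    nW : ℕ                 -- work alphabet is Fin (suc nW); zero is the blank
    nG : ℕ
    q₀ qacc qrej : Fin nQ
    δ  : Fin nQ → TSym → Fin (suc nW) → Fin (suc nG) → Trans nQ (suc nW)

-- a certificate (the prover's one-way message sequence)
Cert : Verifier → Set
Cert V = ℕ → Fin (suc (Verifier.nG V))

record Config (V : Verifier) : Set where
  field
    state : Fin (Verifier.nQ V)
    tape  : ℕ → Fin (suc (Verifier.nW V))
    whead : ℕ
    chead : ℕ

module _ (V : Verifier) where
  open Verifier V

  initConfig : Config V
  initConfig = record { state = q₀ ; tape = λ _ → Fin.zero ; whead = 0 ; chead = 0 }

  apply : Action nQ (suc nW) → Config V → Config V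
  apply act cfg = record
    { state = Action.next act
    ; tape  = λ i → if ⌊ i ≟ℕ Config.whead cfg ⌋ then Action.write act else Config.tape cfg i
    ; whead = mv (Action.wmove act) (Config.whead cfg)
    ; chead = if Action.advance act then suc (Config.chead cfg) else Config.chead cfg
    }
    where
    mv : Move → ℕ → ℕ
    mv left  h = pred h
    mv stay  h = h
    mv right h = suc h

  isAcc isRej isHalt : Config V → Bool
  isAcc cfg = ⌊ Config.state cfg ≟ qacc ⌋
  isRej cfg = ⌊ Config.state cfg ≟ qrej ⌋
  isHalt cfg = if isAcc cfg then true else isRej cfg

  trans : Cert V → TSym → Config V → Trans nQ (suc nW)
  trans w σ cfg = δ (Config.state cfg) σ (Config.tape cfg (Config.whead cfg)) (w (Config.chead cfg))

  -- probability of acceptance, processing the remaining tape cells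
  -- (the machine halts once the input head leaves the tape; it accepts
  -- iff it is then / has been in the accepting state)
  accP : Cert V → List TSym → Config V → ℚ
  accP w [] cfg = if isAcc cfg then 1ℚ else 0ℚ
  accP w (σ ∷ rest) cfg with isHalt cfg
  ... | true  = if isAcc cfg then 1ℚ else 0ℚ
  ... | false with trans w σ cfg
  ...   | det α    = accP w rest (apply α cfg)
  ...   | coin α β = ½ * accP w rest (apply α cfg) + ½ * accP w rest (apply β cfg)

  -- probability of rejection (every non-accepting halt is a rejection)
  rejP : Cert V → List TSym → Config V → ℚ
  rejP w [] cfg = if isAcc cfg then 0ℚ else 1ℚ
  rejP w (σ ∷ rest) cfg with isHalt cfg
  ... | true  = if isAcc cfg then 0ℚ else 1ℚ
  ... | false with trans w σ cfg
  ...   | det α    = rejP w rest (apply α cfg)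
  ...   | coin α β = ½ * rejP w rest (apply α cfg) + ½ * rejP w rest (apply β cfg)

  coins : Cert V → List TSym → Config V → ℕ
  coins w [] cfg = 0
  coins w (σ ∷ rest) cfg with isHalt cfg
  ... | true  = 0
  ... | false with trans w σ cfg
  ...   | det α    = coins w rest (apply α cfg)
  ...   | coin α β = suc (coins w rest (apply α cfg) ⊔ coins w rest (apply β cfg))

  cells : Cert V → List TSym → Config V → ℕ
  cells w [] cfg = suc (Config.whead cfg)
  cells w (σ ∷ rest) cfg with isHalt cfg
  ... | true  = suc (Config.whead cfg)
  ... | false with trans w σ cfg
  ...   | det α    = suc (Config.whead cfg) ⊔ cells w rest (apply α cfg)
  ...   | coin α β = suc (Config.whead cfg) ⊔ (cells w rest (apply α cfg) ⊔ cells w rest (apply β cfg))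

  acceptProb rejectProb : List Sym → Cert V → ℚ
  acceptProb x w = accP w (inputTape x) initConfig
  rejectProb x w = rejP w (inputTape x) initConfig

-- (strong) one-way interactive proof system with error ε for L

IsOnewayIP : (L : List Sym → Set) → Verifier → ℚ → Set
IsOnewayIP L V ε =
    (∀ x → L x → Σ (Cert V) λ w → 1ℚ - ε ≤ℚ acceptProb V x w)
  × (∀ x → ¬ L x → ∀ (w : Cert V) → 1ℚ - ε ≤ℚ rejectProb V x w)

ConsSpace : Verifier → Set
ConsSpace V = Σ ℕ λ s → ∀ x (w : Cert V) → cells V w (inputTape x) (initConfig V) ≤ s

ConsRandomBits : Verifier → Set
ConsRandomBits V = Σ ℕ λ k → ∀ x (w : Cert V) → coins V w (inputTape x) (initConfig V) ≤ k

-- oneway-IP(cons-space, cons-random-bits, rt-input)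
-- (rt-input is built into the Verifier model above)
OnewayIP-cs-crb-rt : (List Sym → Set) → Set
OnewayIP-cs-crb-rt L =
  Σ Verifier λ V → Σ ℚ λ ε → (ε <ℚ ½) × IsOnewayIP L V ε × ConsSpace V × ConsRandomBits V

-- The honest certificate for u c u spells u followed by the end mark c. A coin chooses one of
-- two deterministic checks that read this certificate in real time: one compares the part of
-- the input before c with the certificate and verifies that no second c follows, the other
-- skips to c and compares the rest of the input with the certificate. Since both read the same
-- certificate, they both pass exactly on u c u. A further coin decides whether an accepting
-- verdict is to be weakened to acceptance with probability ½, so words of TWIN are accepted with
-- probability ½ · 1 + ½ · ½ = ¾, while any other input, failing at least one of the two checks,
-- is accepted with probability at most ½ · ½ + ½ · ¼ = 3/8 < ½.
-- Three coins and a single work cell suffice.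

module Submission where

open import Defs
open import Data.Nat using (ℕ; zero; suc; _≤_; _⊔_; z≤n; s≤s)
open import Data.Nat.Properties using (≤-refl; ⊔-lub)
open import Data.Fin using (Fin; zero; suc; #_)
open import Data.Bool using (Bool; true; false; if_then_else_)
open import Data.Maybe using (Maybe; just; nothing)
open import Data.List using (List; []; _∷_; _++_; map; [_])
open import Data.List.Properties using (∷-injective)
open import Data.Vec using (Vec; []; _∷_; lookup)
open import Data.Product using (Σ; _×_; _,_)
open import Data.Integer using (+_)
open import Data.Rational using (ℚ; 0ℚ; 1ℚ; ½; _+_; _*_; _-_; _/_) renaming (_≤_ to _≤ℚ_; _<_ to _<ℚ_)
open import Data.Rational.Properties using (_≤?_; _<?_)
open import Data.Rational.Solver using (module +-*-Solver)
open import Data.Empty using (⊥; ⊥-elim)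
open import Data.Unit using (tt)
open import Relation.Nullary using (¬_)
open import Relation.Nullary.Decidable using (toWitness)
open import Relation.Binary.PropositionalEquality as ≡ using (_≡_; _≢_; refl; cong; cong₂)

mix : ℚ → ℚ → ℚ
mix p q = ½ * p + ½ * q

module _ (V : Verifier) (w : Cert V) where

  Running : Config V → Set
  Running C = isHalt V C ≡ false

  accP-det : ∀ {σ α} l C → Running C → trans V w σ C ≡ det α →
             accP V w (σ ∷ l) C ≡ accP V w l (apply V α C)
  accP-det l C running transition rewrite running | transition = refl

  accP-coin : ∀ {σ α β} l C → Running C → trans V w σ C ≡ coin α β →
              accP V w (σ ∷ l) C ≡ mix (accP V w l (apply V α C)) (accP V w l (apply V β C))
  accP-coin l C running transition rewrite running | transition = refl

  coins-det : ∀ {σ α} l C → Running C → trans V w σ C ≡ det α →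
              coins V w (σ ∷ l) C ≡ coins V w l (apply V α C)
  coins-det l C running transition rewrite running | transition = refl

  coins-coin : ∀ {σ α β} l C → Running C → trans V w σ C ≡ coin α β →
               coins V w (σ ∷ l) C ≡ suc (coins V w l (apply V α C) ⊔ coins V w l (apply V β C))
  coins-coin l C running transition rewrite running | transition = refl

  -- Every run ends in the accepting or the rejecting state.
  rejP≡1-accP : ∀ l C → rejP V w l C ≡ 1ℚ - accP V w l C
  rejP≡1-accP [] C with isAcc V C
  ... | true  = refl
  ... | false = refl
  rejP≡1-accP (σ ∷ l) C with isHalt V C
  rejP≡1-accP (σ ∷ l) C | true with isAcc V C
  ... | true  = refl
  ... | false = refl
  rejP≡1-accP (σ ∷ l) C | false with trans V w σ C
  ... | det α    = rejP≡1-accP l (apply V α C)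
  ... | coin α β = ≡.trans (cong₂ mix (rejP≡1-accP l (apply V α C)) (rejP≡1-accP l (apply V β C)))
                           (mix-1- (accP V w l (apply V α C)) (accP V w l (apply V β C)))
    where
    mix-1- : ∀ p q → mix (1ℚ - p) (1ℚ - q) ≡ 1ℚ - mix p q
    mix-1- = solve 2 (λ p q → con ½ :* (con 1ℚ :- p) :+ con ½ :* (con 1ℚ :- q)
                           := con 1ℚ :- (con ½ :* p :+ con ½ :* q)) refl
      where open +-*-Solver

  rejectProb≡1-acceptProb : ∀ x → rejectProb V x w ≡ 1ℚ - acceptProb V x w
  rejectProb≡1-acceptProb x = rejP≡1-accP (inputTape x) (initConfig V)

KeepsHead : ∀ {nQ nW} → Trans nQ nW → Set
KeepsHead (det α)    = Action.wmove α ≡ stay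
KeepsHead (coin α β) = Action.wmove α ≡ stay × Action.wmove β ≡ stay

module _ (V : Verifier) (keepsHead : ∀ q σ s g → KeepsHead (Verifier.δ V q σ s g)) where

  whead-apply-stay : ∀ α C → Action.wmove α ≡ stay → Config.whead C ≡ 0 → Config.whead (apply V α C) ≡ 0
  whead-apply-stay α C stays atZero rewrite stays | atZero = refl

  cells≤1 : ∀ w l C → Config.whead C ≡ 0 → cells V w l C ≤ 1
  cells≤1 w []      C atZero rewrite atZero = ≤-refl
  cells≤1 w (σ ∷ l) C atZero with isHalt V C
  ... | true rewrite atZero = ≤-refl
  ... | false with trans V w σ C | keepsHead (Config.state C) σ (Config.tape C (Config.whead C)) (w (Config.chead C))
  ...   | det α    | stays rewrite atZero =
          ⊔-lub ≤-refl (cells≤1 w l _ (whead-apply-stay α C stays atZero))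
  ...   | coin α β | staysα , staysβ rewrite atZero =
          ⊔-lub ≤-refl (⊔-lub (cells≤1 w l _ (whead-apply-stay α C staysα atZero))
                              (cells≤1 w l _ (whead-apply-stay β C staysβ atZero)))

Msg : Set
Msg = Fin 3

pattern ma = zero
pattern mb = suc zero
pattern mc = suc (suc zero)

code : Sym → Msg
code a = ma
code b = mb
code c = mc

data Spells (w : ℕ → Msg) : ℕ → List Sym → Set where
  []  : ∀ {k} → w k ≡ mc → Spells w k []
  _∷_ : ∀ {k s u} → w k ≡ code s → Spells w (suc k) u → Spells w k (s ∷ u)

Spells-suc : ∀ {w k u} → Spells (λ i → w (suc i)) k u → Spells w (suc k) u
Spells-suc ([] e)  = [] e
Spells-suc (e ∷ m) = e ∷ Spells-suc m

spell : List Sym → ℕ → Msg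
spell []      _       = mc
spell (s ∷ u) zero    = code s
spell (s ∷ u) (suc i) = spell u i

Spells-spell : ∀ u → Spells (spell u) 0 u
Spells-spell []      = [] refl
Spells-spell (s ∷ u) = refl ∷ Spells-suc (Spells-spell u)

code-injective : ∀ {s s′} → code s ≡ code s′ → s ≡ s′
code-injective {a} {a} _ = refl
code-injective {b} {b} _ = refl
code-injective {c} {c} _ = refl
code-injective {a} {b} ()
code-injective {a} {c} ()
code-injective {b} {a} ()
code-injective {b} {c} ()
code-injective {c} {a} ()
code-injective {c} {b} ()

code≢mc : ∀ {s} → IsAB s → code s ≢ mc
code≢mc isA ()
code≢mc isB ()

Spells-injective : ∀ {w k u v} → AllAB u → AllAB v → Spells w k u → Spells w k v → u ≡ v
Spells-injective []       []       _        _        = refl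
Spells-injective []       (p ∷ _)  ([] e)   (e′ ∷ _) = ⊥-elim (code≢mc p (≡.trans (≡.sym e′) e))
Spells-injective (p ∷ _)  []       (e ∷ _)  ([] e′)  = ⊥-elim (code≢mc p (≡.trans (≡.sym e) e′))
Spells-injective (p ∷ pu) (q ∷ qv) (e ∷ m) (e′ ∷ m′) =
  cong₂ _∷_ (code-injective (≡.trans (≡.sym e) e′)) (Spells-injective pu qv m m′)

++-c-injective : ∀ {u v u′ v′} → AllAB u → AllAB u′ → u ++ c ∷ v ≡ u′ ++ c ∷ v′ → u ≡ u′ × v ≡ v′
++-c-injective []         []          refl = refl , refl
++-c-injective []         (isA ∷ _)   ()
++-c-injective []         (isB ∷ _)   ()
++-c-injective (isA ∷ _)  []          ()
++-c-injective (isB ∷ _)  []          ()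
++-c-injective (_ ∷ pu)   (_ ∷ pu′)   e with ∷-injective e
... | refl , e′ with ++-c-injective pu pu′ e′
...   | refl , refl = refl , refl

record Split (x : List Sym) : Set where
  field
    before after : List Sym
    before-AB    : AllAB before
    after-AB     : AllAB after
    x≡           : x ≡ before ++ c ∷ after

data Phase : Set where
  matchPrefix scanSuffix skipPrefix matchSuffix : Phase

-- nothing rejects; otherwise the next phase and whether the certificate head advances.
step : Phase → Sym → Msg → Maybe (Phase × Bool)
step matchPrefix a ma = just (matchPrefix , true)
step matchPrefix b mb = just (matchPrefix , true)
step matchPrefix c mc = just (scanSuffix , false)
step matchPrefix _ _  = nothing
step scanSuffix  c _  = nothing
step scanSuffix  _ _  = just (scanSuffix , false)
step skipPrefix  c _  = just (matchSuffix , false)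
step skipPrefix  _ _  = just (skipPrefix , false)
step matchSuffix a ma = just (matchSuffix , true)
step matchSuffix b mb = just (matchSuffix , true)
step matchSuffix _ _  = nothing

atEnd : Phase → Msg → Bool
atEnd scanSuffix  _  = true
atEnd matchSuffix mc = true
atEnd _           _  = false

Split-∷ : ∀ {s x} → IsAB s → Split x → Split (s ∷ x)
Split-∷ p sp = record
  { before = _ ∷ before ; after = after ; before-AB = p ∷ before-AB ; after-AB = after-AB ; x≡ = cong (_ ∷_) x≡ }
  where open Split sp

Split-c∷ : ∀ {x} → AllAB x → Split (c ∷ x)
Split-c∷ p = record { before = [] ; after = _ ; before-AB = [] ; after-AB = p ; x≡ = refl }

module Checks (w : ℕ → Msg) where
  open Split

  mutual
    passes : Phase → List Sym → ℕ → Bool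
    passes p []      k = atEnd p (w k)
    passes p (s ∷ x) k = continues (step p s (w k)) x k

    continues : Maybe (Phase × Bool) → List Sym → ℕ → Bool
    continues nothing          _ _ = false
    continues (just (p , adv)) x k = passes p x (if adv then suc k else k)

  scanSuffix-sound : ∀ x k → passes scanSuffix x k ≡ true → AllAB x
  scanSuffix-sound []      k _ = []
  scanSuffix-sound (a ∷ x) k h = isA ∷ scanSuffix-sound x k h
  scanSuffix-sound (b ∷ x) k h = isB ∷ scanSuffix-sound x k h
  scanSuffix-sound (c ∷ x) k ()

  matchPrefix-sound : ∀ x k → passes matchPrefix x k ≡ true → Σ (Split x) λ sp → Spells w k (before sp)
  matchPrefix-sound []      k ()
  matchPrefix-sound (s ∷ x) k h with s | w k in e
  ... | a | ma = let sp , m = matchPrefix-sound x (suc k) h in Split-∷ isA sp , e ∷ m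
  ... | b | mb = let sp , m = matchPrefix-sound x (suc k) h in Split-∷ isB sp , e ∷ m
  ... | c | mc = Split-c∷ (scanSuffix-sound x k h) , [] e
  matchPrefix-sound (s ∷ x) k () | a | mb
  matchPrefix-sound (s ∷ x) k () | a | mc
  matchPrefix-sound (s ∷ x) k () | b | ma
  matchPrefix-sound (s ∷ x) k () | b | mc
  matchPrefix-sound (s ∷ x) k () | c | ma
  matchPrefix-sound (s ∷ x) k () | c | mb

  matchSuffix-sound : ∀ x k → passes matchSuffix x k ≡ true → AllAB x × Spells w k x
  matchSuffix-sound [] k h with w k in e
  ... | mc = [] , [] e
  matchSuffix-sound [] k () | ma
  matchSuffix-sound [] k () | mb
  matchSuffix-sound (s ∷ x) k h with s | w k in e
  ... | a | ma = let p , m = matchSuffix-sound x (suc k) h in isA ∷ p , e ∷ m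
  ... | b | mb = let p , m = matchSuffix-sound x (suc k) h in isB ∷ p , e ∷ m
  matchSuffix-sound (s ∷ x) k () | a | mb
  matchSuffix-sound (s ∷ x) k () | a | mc
  matchSuffix-sound (s ∷ x) k () | b | ma
  matchSuffix-sound (s ∷ x) k () | b | mc
  matchSuffix-sound (s ∷ x) k () | c | _

  skipPrefix-sound : ∀ x k → passes skipPrefix x k ≡ true → Σ (Split x) λ sp → Spells w k (after sp)
  skipPrefix-sound []      k ()
  skipPrefix-sound (a ∷ x) k h = let sp , m = skipPrefix-sound x k h in Split-∷ isA sp , m
  skipPrefix-sound (b ∷ x) k h = let sp , m = skipPrefix-sound x k h in Split-∷ isB sp , m
  skipPrefix-sound (c ∷ x) k h = let p , m = matchSuffix-sound x k h in Split-c∷ p , m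

  scanSuffix-complete : ∀ {x} k → AllAB x → passes scanSuffix x k ≡ true
  scanSuffix-complete k []        = refl
  scanSuffix-complete k (isA ∷ p) = scanSuffix-complete k p
  scanSuffix-complete k (isB ∷ p) = scanSuffix-complete k p

  matchPrefix-complete : ∀ {u v k} → AllAB u → AllAB v → Spells w k u → passes matchPrefix (u ++ c ∷ v) k ≡ true
  matchPrefix-complete {k = k} []        q ([] e)  rewrite e = scanSuffix-complete k q
  matchPrefix-complete         (isA ∷ p) q (e ∷ m) rewrite e = matchPrefix-complete p q m
  matchPrefix-complete         (isB ∷ p) q (e ∷ m) rewrite e = matchPrefix-complete p q m

  matchSuffix-complete : ∀ {v k} → AllAB v → Spells w k v → passes matchSuffix v k ≡ true
  matchSuffix-complete []        ([] e)  rewrite e = refl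
  matchSuffix-complete (isA ∷ q) (e ∷ m) rewrite e = matchSuffix-complete q m
  matchSuffix-complete (isB ∷ q) (e ∷ m) rewrite e = matchSuffix-complete q m

  skipPrefix-complete : ∀ {u v k} → AllAB u → AllAB v → Spells w k v → passes skipPrefix (u ++ c ∷ v) k ≡ true
  skipPrefix-complete []        q m = matchSuffix-complete q m
  skipPrefix-complete (isA ∷ p) q m = skipPrefix-complete p q m
  skipPrefix-complete (isB ∷ p) q m = skipPrefix-complete p q m

  both-pass⇒TWIN : ∀ x → passes matchPrefix x 0 ≡ true → passes skipPrefix x 0 ≡ true → TWIN x
  both-pass⇒TWIN x passA passB with matchPrefix-sound x 0 passA | skipPrefix-sound x 0 passB
  ... | sp , spellsBefore | sp′ , spellsAfter′
    with ++-c-injective (before-AB sp) (before-AB sp′) (≡.trans (≡.sym (x≡ sp)) (x≡ sp′))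
  ... | refl , refl with Spells-injective (before-AB sp) (after-AB sp) spellsBefore spellsAfter′
  ... | refl = before sp , before-AB sp , x≡ sp

-- The Bool is the first coin: when it is true, an accepting verdict at $ is kept only with probability ½.
data State : Set where
  start : State
  pick  : Bool → State
  run   : Phase → Bool → State

states : Vec State 11
states = start ∷ pick false ∷ pick true
       ∷ run matchPrefix false ∷ run matchPrefix true ∷ run scanSuffix false ∷ run scanSuffix true
       ∷ run skipPrefix false ∷ run skipPrefix true ∷ run matchSuffix false ∷ run matchSuffix true ∷ []

index : State → Fin 11
index start                   = # 0
index (pick false)            = # 1
index (pick true)             = # 2
index (run matchPrefix false) = # 3
index (run matchPrefix true)  = # 4
index (run scanSuffix false)  = # 5
index (run scanSuffix true)   = # 6
index (run skipPrefix false)  = # 7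
index (run skipPrefix true)   = # 8
index (run matchSuffix false) = # 9
index (run matchSuffix true)  = # 10

lookup-index : ∀ q → lookup states (index q) ≡ q
lookup-index start                   = refl
lookup-index (pick false)            = refl
lookup-index (pick true)             = refl
lookup-index (run matchPrefix false) = refl
lookup-index (run matchPrefix true)  = refl
lookup-index (run scanSuffix false)  = refl
lookup-index (run scanSuffix true)   = refl
lookup-index (run skipPrefix false)  = refl
lookup-index (run skipPrefix true)   = refl
lookup-index (run matchSuffix false) = refl
lookup-index (run matchSuffix true)  = refl

-- Verifier state 0 accepts, 1 rejects, and ⌜ q ⌝ is the running state q.
⌜_⌝ : State → Fin 13
⌜ q ⌝ = suc (suc (index q))

goto : Fin 13 → Bool → Action 13 1
goto q adv = record { next = q ; write = zero ; wmove = stay ; advance = adv }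

halt : Bool → Action 13 1
halt r = goto (if r then zero else suc zero) false

resume : Bool → Maybe (Phase × Bool) → Action 13 1
resume d nothing          = halt false
resume d (just (p , adv)) = goto ⌜ run p d ⌝ adv

δ : State → TSym → Msg → Trans 13 1
δ start         _       _ = coin (goto ⌜ pick false ⌝ false) (goto ⌜ pick true ⌝ false)
δ (pick d)      (sym s) g = coin (resume d (step matchPrefix s g)) (resume d (step skipPrefix s g))
δ (pick d)      _       _ = det (halt false)
δ (run p d)     (sym s) g = det (resume d (step p s g))
δ (run p false) $       g = det (halt (atEnd p g))
δ (run p true)  $       g = coin (halt (atEnd p g)) (halt false)
δ (run p d)     ¢       _ = det (halt false)

δV : Fin 13 → TSym → Fin 1 → Msg → Trans 13 1
δV (suc (suc i)) σ _ g = δ (lookup states i) σ g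
δV _             _ _ _ = det (halt false)  -- never consulted: runs stop in a halting state

V : Verifier
V = record { nQ = 13 ; nW = 0 ; nG = 2 ; q₀ = ⌜ start ⌝ ; qacc = zero ; qrej = suc zero ; δ = δV }

config : Fin 13 → (ℕ → Fin 1) → ℕ → Config V
config q t k = record { state = q ; tape = t ; whead = 0 ; chead = k }

body : List Sym → List TSym
body x = map sym x ++ [ $ ]

credit : Bool → Bool → ℚ
credit d r = if r then (if d then ½ else 1ℚ) else 0ℚ

acceptance : Bool → Bool → ℚ
acceptance p q = mix (mix (credit false p) (credit false q)) (mix (credit true p) (credit true q))

module Run (w : Cert V) where
  open Checks w

  trans-run : ∀ q σ t k → trans V w σ (config ⌜ q ⌝ t k) ≡ δ q σ (w k)
  trans-run q σ t k = cong (λ q′ → δ q′ σ (w k)) (lookup-index q)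

  accP-rejected : ∀ l C → accP V w l (apply V (halt false) C) ≡ 0ℚ
  accP-rejected []      C = refl
  accP-rejected (_ ∷ _) C = refl

  accP-halt : ∀ r C → accP V w [] (apply V (halt r) C) ≡ credit false r
  accP-halt true  C = refl
  accP-halt false C = refl

  accP-halt-or-reject : ∀ r C →
    mix (accP V w [] (apply V (halt r) C)) (accP V w [] (apply V (halt false) C)) ≡ credit true r
  accP-halt-or-reject true  C = refl
  accP-halt-or-reject false C = refl

  mutual
    accP-run : ∀ p d x t k → accP V w (body x) (config ⌜ run p d ⌝ t k) ≡ credit d (passes p x k)
    accP-run p false [] t k =
      ≡.trans (accP-det V w [] (config ⌜ run p false ⌝ t k) refl (trans-run (run p false) $ t k))
              (accP-halt (atEnd p (w k)) (config ⌜ run p false ⌝ t k))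
    accP-run p true [] t k =
      ≡.trans (accP-coin V w [] (config ⌜ run p true ⌝ t k) refl (trans-run (run p true) $ t k))
              (accP-halt-or-reject (atEnd p (w k)) (config ⌜ run p true ⌝ t k))
    accP-run p d (s ∷ x) t k =
      ≡.trans (accP-det V w (body x) (config ⌜ run p d ⌝ t k) refl (trans-run (run p d) (sym s) t k))
              (accP-resume d x ⌜ run p d ⌝ t k (step p s (w k)))

    accP-resume : ∀ d x q t k o → accP V w (body x) (apply V (resume d o) (config q t k)) ≡ credit d (continues o x k)
    accP-resume false x q t k nothing          = accP-rejected (body x) (config q t k)
    accP-resume true  x q t k nothing          = accP-rejected (body x) (config q t k)
    accP-resume d     x q t k (just (p , adv)) = accP-run p d x _ _

  acceptProb-checks : ∀ x → acceptProb V x w ≡ acceptance (passes matchPrefix x 0) (passes skipPrefix x 0)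
  acceptProb-checks []      = refl
  -- The coins tossed at ¢ and at the first input symbol unfold definitionally.
  acceptProb-checks (s ∷ x) =
    cong₂ mix (cong₂ mix (accP-resume false x ⌜ pick false ⌝ _ 0 (step matchPrefix s (w 0)))
                         (accP-resume false x ⌜ pick false ⌝ _ 0 (step skipPrefix s (w 0))))
              (cong₂ mix (accP-resume true x ⌜ pick true ⌝ _ 0 (step matchPrefix s (w 0)))
                         (accP-resume true x ⌜ pick true ⌝ _ 0 (step skipPrefix s (w 0))))

  mutual
    coins-run : ∀ p d x t k → coins V w (body x) (config ⌜ run p d ⌝ t k) ≤ 1
    coins-run p false [] t k
      rewrite coins-det V w [] (config ⌜ run p false ⌝ t k) refl (trans-run (run p false) $ t k) = z≤n
    coins-run p true [] t k
      rewrite coins-coin V w [] (config ⌜ run p true ⌝ t k) refl (trans-run (run p true) $ t k) = ≤-refl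
    coins-run p d (s ∷ x) t k
      rewrite coins-det V w (body x) (config ⌜ run p d ⌝ t k) refl (trans-run (run p d) (sym s) t k) =
      coins-resume d x ⌜ run p d ⌝ t k (step p s (w k))

    coins-resume : ∀ d x q t k o → coins V w (body x) (apply V (resume d o) (config q t k)) ≤ 1
    coins-resume d x q t k nothing          = coins-rejected (body x)
      where
      coins-rejected : ∀ l → coins V w l (apply V (halt false) (config q t k)) ≤ 1
      coins-rejected []      = z≤n
      coins-rejected (_ ∷ _) = z≤n
    coins-resume d x q t k (just (p , adv)) = coins-run p d x _ _

  coins≤3 : ∀ x → coins V w (inputTape x) (initConfig V) ≤ 3
  coins≤3 []      = s≤s z≤n
  coins≤3 (s ∷ x) = s≤s (⊔-lub (coins-pick false _) (coins-pick true _))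
    where
    coins-pick : ∀ d t → coins V w (sym s ∷ body x) (config ⌜ pick d ⌝ t 0) ≤ 2
    coins-pick d t
      rewrite coins-coin V w (body x) (config ⌜ pick d ⌝ t 0) refl (trans-run (pick d) (sym s) t 0) =
      s≤s (⊔-lub (coins-resume d x ⌜ pick d ⌝ t 0 (step matchPrefix s (w 0)))
                 (coins-resume d x ⌜ pick d ⌝ t 0 (step skipPrefix s (w 0))))

resume-keepsHead : ∀ d o → Action.wmove (resume d o) ≡ stay
resume-keepsHead d nothing  = refl
resume-keepsHead d (just _) = refl

δ-keepsHead : ∀ q σ g → KeepsHead (δ q σ g)
δ-keepsHead start         _       _ = refl , refl
δ-keepsHead (pick d)      (sym s) g = resume-keepsHead d (step matchPrefix s g) , resume-keepsHead d (step skipPrefix s g)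
δ-keepsHead (pick d)      ¢       _ = refl
δ-keepsHead (pick d)      $       _ = refl
δ-keepsHead (run p d)     (sym s) g = resume-keepsHead d (step p s g)
δ-keepsHead (run p false) $       _ = refl
δ-keepsHead (run p true)  $       _ = refl , refl
δ-keepsHead (run p d)     ¢       _ = refl

δV-keepsHead : ∀ q σ s g → KeepsHead (δV q σ s g)
δV-keepsHead zero          _ _ _ = refl
δV-keepsHead (suc zero)    _ _ _ = refl
δV-keepsHead (suc (suc i)) σ _ g = δ-keepsHead (lookup states i) σ g

ε : ℚ
ε = + 3 / 8

ε<½ : ε <ℚ ½
ε<½ = toWitness {a? = ε <? ½} tt

acceptance-both : 1ℚ - ε ≤ℚ acceptance true true
acceptance-both = toWitness {a? = 1ℚ - ε ≤? acceptance true true} tt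

rejection-unless-both : ∀ p q → (p ≡ true → q ≡ true → ⊥) → 1ℚ - ε ≤ℚ 1ℚ - acceptance p q
rejection-unless-both true  true  notBoth = ⊥-elim (notBoth refl refl)
rejection-unless-both true  false _       = toWitness {a? = 1ℚ - ε ≤? 1ℚ - acceptance true false} tt
rejection-unless-both false true  _       = toWitness {a? = 1ℚ - ε ≤? 1ℚ - acceptance false true} tt
rejection-unless-both false false _       = toWitness {a? = 1ℚ - ε ≤? 1ℚ - acceptance false false} tt

TWIN-accepted : ∀ x → TWIN x → Σ (Cert V) λ w → 1ℚ - ε ≤ℚ acceptProb V x w
TWIN-accepted _ (u , p , refl) =
  spell u , ≡.subst (1ℚ - ε ≤ℚ_) (≡.sym (≡.trans (Run.acceptProb-checks w x) (cong₂ acceptance passA passB)))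
                    acceptance-both
  where
  w = spell u
  x = u ++ c ∷ u
  passA = Checks.matchPrefix-complete w p p (Spells-spell u)
  passB = Checks.skipPrefix-complete w p p (Spells-spell u)

¬TWIN-rejected : ∀ x → ¬ TWIN x → ∀ w → 1ℚ - ε ≤ℚ rejectProb V x w
¬TWIN-rejected x notTwin w =
  ≡.subst (1ℚ - ε ≤ℚ_) (≡.sym (≡.trans (rejectProb≡1-acceptProb V w x) (cong (1ℚ -_) (Run.acceptProb-checks w x))))
          (rejection-unless-both _ _ λ passA passB → notTwin (Checks.both-pass⇒TWIN w x passA passB))

theorem5 : OnewayIP-cs-crb-rt TWIN
theorem5 = V , ε , ε<½ , (TWIN-accepted , ¬TWIN-rejected)
         , (1 , λ x w → cells≤1 V δV-keepsHead w (inputTape x) (initConfig V) refl)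
         , (3 , λ x w → Run.coins≤3 w x)
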